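{- Let $K$ be a valued field and $d \geq 1$. Then the Helly number of $\operatorname{Conv}_{K^d}$ is $d+1$. That is: for any $n$ and any convex sets $S_1,\ldots,S_n \subseteq K^d$ such that every $(d+1)$-element subset of $\{S_1,\ldots,S_n\}$ has nonempty intersection, we have $\bigcap_{i \in [n]} S_i \neq \emptyset$; and $d+1$ is the least number with this property.
   Context: $K$ is a field with a valuation $\nu$ and valuation ring $\mathcal{O} = \{x : \nu(x)\ge 0\}$. A set $X \subseteq K^d$ is convex if for all $n\ge1$, $x_1,\ldots,x_n \in X$ and $\alpha_1,\ldots,\alpha_n \in \mathcal{O}$ with $\sum\alpha_i = 1$, $\sum \alpha_i x_i \in X$; $\operatorname{Conv}_{K^d}$ denotes the family of convex subsets of $K^d$. A family $\mathcal{F}$ has Helly number $k$ if $k$ is minimal such that for any $n$ and $S_1,\ldots,S_n \in \mathcal{F}$, if every $k$-subset of $\{S_1,\ldots,S_n\}$ has nonempty intersection then $\bigcap_i S_i \neq \emptyset$. -}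

module Defs where

open import Level using (Level; _⊔_) renaming (suc to lsuc)
open import Algebra.Bundles using (CommutativeRing; AbelianGroup)
import Algebra.Definitions.RawMonoid as RawMonoidDefs
open import Relation.Binary.Structures using (IsTotalOrder)
open import Relation.Binary.Core using (Rel)
open import Data.Maybe using (Maybe; just; nothing)
open import Data.Nat using (ℕ; suc; _<_)
import Data.Nat as ℕ
open import Data.Fin using (Fin)
open import Data.Fin.Subset using (Subset; _∈_; ∣_∣)
open import Relation.Binary.PropositionalEquality using (_≡_)
open import Data.Sum using (inj₁; inj₂)
open import Data.Product using (Σ; ∃; _×_; _,_)
open import Data.Unit.Polymorphic using (⊤)
open import Data.Empty.Polymorphic using (⊥)
open import Relation.Nullary using (¬_)

record OrderedAbelianGroup (g ℓ₁ ℓ₂ : Level) : Set (lsuc (g ⊔ ℓ₁ ⊔ ℓ₂)) where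
  field
    abelianGroup : AbelianGroup g ℓ₁
  open AbelianGroup abelianGroup public
  field
    _≤_          : Rel Carrier ℓ₂
    isTotalOrder : IsTotalOrder _≈_ _≤_
    +-mono-≤     : ∀ {x y} z → x ≤ y → (x ∙ z) ≤ (y ∙ z)

-- Γ ∪ {∞}, with ∞ represented by nothing
module Γ∞ {g ℓ₁ ℓ₂} (Γ : OrderedAbelianGroup g ℓ₁ ℓ₂) where
  open OrderedAbelianGroup Γ

  _+∞_ : Maybe Carrier → Maybe Carrier → Maybe Carrier
  just a +∞ just b = just (a ∙ b)
  _      +∞ _      = nothing

  _≤∞_ : Maybe Carrier → Maybe Carrier → Set ℓ₂
  _      ≤∞ nothing = ⊤
  nothing ≤∞ just _ = ⊥
  just a ≤∞ just b  = a ≤ b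

  min∞ : Maybe Carrier → Maybe Carrier → Maybe Carrier
  min∞ nothing b = b
  min∞ (just a) nothing = just a
  min∞ (just a) (just b) with IsTotalOrder.total isTotalOrder a b
  ... | inj₁ _ = just a
  ... | inj₂ _ = just b

  _≈∞_ : Maybe Carrier → Maybe Carrier → Set ℓ₁
  nothing ≈∞ nothing = ⊤
  just a  ≈∞ just b  = a ≈ b
  _       ≈∞ _       = ⊥

record Field (c ℓ : Level) : Set (lsuc (c ⊔ ℓ)) where
  field
    commutativeRing : CommutativeRing c ℓ
  open CommutativeRing commutativeRing public
  field
    0≉1     : ¬ (0# ≈ 1#)
    inverse : ∀ x → ¬ (x ≈ 0#) → ∃ λ y → (x * y) ≈ 1#

record ValuedField (c ℓ g ℓ₁ ℓ₂ : Level) : Set (lsuc (c ⊔ ℓ ⊔ g ⊔ ℓ₁ ⊔ ℓ₂)) where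
  field
    field'     : Field c ℓ
    valueGroup : OrderedAbelianGroup g ℓ₁ ℓ₂
  open Field field' public
  open Γ∞ valueGroup public
  open OrderedAbelianGroup valueGroup public
    using () renaming (Carrier to Γ; _≤_ to _≤Γ_; ε to 0Γ)
  field
    ν        : Carrier → Maybe Γ
    ν-cong   : ∀ {x y} → x ≈ y → ν x ≈∞ ν y
    ν-0      : ν 0# ≡ nothing
    ν-∞⇒0    : ∀ x → ν x ≡ nothing → x ≈ 0#
    ν-*      : ∀ x y → ν (x * y) ≈∞ (ν x +∞ ν y)
    ν-+      : ∀ x y → min∞ (ν x) (ν y) ≤∞ ν (x + y)

module _ {c ℓ g ℓ₁ ℓ₂ : Level} (K : ValuedField c ℓ g ℓ₁ ℓ₂) where
  open ValuedField K
  open RawMonoidDefs +-rawMonoid using (sum)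

  𝒪 : Carrier → Set ℓ₂
  𝒪 x = just 0Γ ≤∞ ν x

  Point : ℕ → Set c
  Point d = Fin d → Carrier

  _≈ᵈ_ : ∀ {d} → Point d → Point d → Set ℓ
  x ≈ᵈ y = ∀ j → x j ≈ y j

  record SubsetKᵈ (p : Level) (d : ℕ) : Set (c ⊔ ℓ ⊔ lsuc p) where
    field
      _∋_   : Point d → Set p
      resp  : ∀ {x y} → x ≈ᵈ y → _∋_ x → _∋_ y
  open SubsetKᵈ public

  combination : ∀ {n d} → (Fin n → Carrier) → (Fin n → Point d) → Point d
  combination α x j = sum (λ i → α i * x i j)

  IsConvex : ∀ {p d} → SubsetKᵈ p d → Set (c ⊔ ℓ ⊔ ℓ₂ ⊔ p)
  IsConvex {d = d} X =
    ∀ (n : ℕ) (x : Fin (suc n) → Point d) (α : Fin (suc n) → Carrier) →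
    (∀ i → X ∋ x i) → (∀ i → 𝒪 (α i)) → sum α ≈ 1# →
    X ∋ combination α x

  record ConvexSet (p : Level) (d : ℕ) : Set (c ⊔ ℓ ⊔ ℓ₂ ⊔ lsuc p) where
    field
      set    : SubsetKᵈ p d
      convex : IsConvex set
  open ConvexSet public

  MeetsOn : ∀ {p d n} → (Fin n → ConvexSet p d) → Subset n → Set (c ⊔ p)
  MeetsOn {d = d} S I = Σ (Point d) λ x → ∀ i → i ∈ I → set (S i) ∋ x

  Meets : ∀ {p d n} → (Fin n → ConvexSet p d) → Set (c ⊔ p)
  Meets {d = d} S = Σ (Point d) λ x → ∀ i → set (S i) ∋ x

  HellyProperty : (p : Level) (d k : ℕ) → Set (c ⊔ ℓ ⊔ ℓ₂ ⊔ lsuc p)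
  HellyProperty p d k =
    ∀ (n : ℕ) (S : Fin n → ConvexSet p d) →
    (∀ (I : Subset n) → ∣ I ∣ ℕ.≤ k → MeetsOn S I) → Meets S

  HellyNumber : (p : Level) (d k : ℕ) → Set (c ⊔ ℓ ⊔ ℓ₂ ⊔ lsuc p)
  HellyNumber p d k = HellyProperty p d k × (∀ m → m < k → ¬ HellyProperty p d m)

-- Radon's lemma holds over any valued field: among more than d + 1 points xⱼ of K^d
-- one is an 𝒪-convex combination of the others. Take an affine dependence Σ λⱼ xⱼ = 0,
-- Σ λⱼ = 0 and divide it by the coefficient λₖ of least valuation: the weights −λⱼ/λₖ
-- then lie in 𝒪, sum to 1 and express xₖ through the other points. Helly's theorem
-- follows as for real convexity: if a family meets on every subfamily missing one set,
-- choose a point xⱼ in the subfamily missing Sⱼ; the Radon point xₖ lies in Sₖ by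
-- convexity and in every other Sᵢ by choice. The number d + 1 is optimal because the
-- affine hyperplane Σ xᵢ = 1 and the d coordinate hyperplanes xᵢ = 0 have no common
-- point, although any d of them meet.

module Submission where

open import Defs
open import Level using (Level; Lift; lift; lower; _⊔_)
import Algebra.Properties.Group as GroupProperties
open import Data.Maybe using (just; nothing)
open import Data.Nat as ℕ using (ℕ; zero; suc; _<_; _≥_)
open import Data.Fin using (Fin; zero; suc)
open import Data.Product using (Σ; ∃; _×_; _,_; proj₁; proj₂)
open import Data.Sum using (_⊎_; inj₁; inj₂)
open import Relation.Binary.Structures using (IsTotalOrder; IsTotalPreorder)
open import Relation.Binary.PropositionalEquality as ≡ using (_≡_; _≢_; ≢-sym)
open import Relation.Nullary using (¬_; Dec; yes; no)
open import Relation.Nullary.Decidable using (map′; ¬?; _×-dec_; decidable-stable; True; toWitness; fromWitness)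
open import Data.Fin.Properties using (any?; punchInᵢ≢i)
open import Data.Fin.Subset using (Subset; _∈_; _∉_; ∣_∣; ∁; ⊤; Nonempty; outside; inside) renaming (_-_ to _∖_)
open import Data.Fin.Subset.Properties
  using (_∈?_; x∈p∧x≢y⇒x∈p-y; p─q⊆p; p─⊥≡p; nonempty?; Empty-unique; ∣⊥∣≡0; ∣∁p∣≡n∸∣p∣; x∈∁p⇒x∉p;
         x∈p⇒∣p-x∣<∣p∣; ∣p∣≤n; ∈⊤)
import Data.Nat.Properties as ℕ
open import Data.Vec using (_∷_; here; there)
open import Data.Vec.Functional using (removeAt)
open import Function using (_∘_; case_of_)
open import Relation.Binary.Core using (Rel)
import Data.Fin as Fin
import Data.Empty

0<∣p∣⇒nonempty : ∀ {n} {p : Subset n} → 0 < ∣ p ∣ → Nonempty p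
0<∣p∣⇒nonempty {n} {p} 0<∣p∣ with nonempty? p
... | yes nonempty = nonempty
... | no  empty    = Data.Empty.⊥-elim (ℕ.<-irrefl ≡.refl (≡.subst (0 <_) ∣p∣≡0 0<∣p∣))
  where
  ∣p∣≡0 : ∣ p ∣ ≡ 0
  ∣p∣≡0 = ≡.trans (≡.cong ∣_∣ (Empty-unique empty)) (∣⊥∣≡0 n)

∣p∣<n⇒∃∉ : ∀ {n} {p : Subset n} → ∣ p ∣ < n → ∃ λ x → x ∉ p
∣p∣<n⇒∃∉ {n} {p} ∣p∣<n with 0<∣p∣⇒nonempty {p = ∁ p} (≡.subst (0 <_) (≡.sym (∣∁p∣≡n∸∣p∣ p)) (ℕ.m<n⇒0<n∸m ∣p∣<n))
... | x , x∈∁p = x , x∈∁p⇒x∉p x∈∁p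

x∉p∖x : ∀ {n} (p : Subset n) {x} → x ∉ p ∖ x
x∉p∖x (_ ∷ p) {zero}  ()
x∉p∖x (_ ∷ p) {suc x} (there x∈p∖x) = x∉p∖x p x∈p∖x

x∈p∖y⇒x≢y : ∀ {n} {p : Subset n} {x y} → x ∈ p ∖ y → x ≢ y
x∈p∖y⇒x≢y {p = p} x∈p∖x ≡.refl = x∉p∖x p x∈p∖x

x∈p⇒∣p∣≡1+∣p∖x∣ : ∀ {n} {p : Subset n} {x} → x ∈ p → ∣ p ∣ ≡ suc ∣ p ∖ x ∣
x∈p⇒∣p∣≡1+∣p∖x∣ {p = inside  ∷ p} {zero}  here         = ≡.cong (suc ∘ ∣_∣) (≡.sym (p─⊥≡p p))
x∈p⇒∣p∣≡1+∣p∖x∣ {p = inside  ∷ p} {suc x} (there x∈p) = ≡.cong suc (x∈p⇒∣p∣≡1+∣p∖x∣ x∈p)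
x∈p⇒∣p∣≡1+∣p∖x∣ {p = outside ∷ p} {suc x} (there x∈p) = x∈p⇒∣p∣≡1+∣p∖x∣ x∈p

choose-on : ∀ {a b n} {A : Set a} {P : Fin n → A → Set b} (I : Subset n) → A →
            (∀ j → j ∈ I → Σ A (P j)) → Σ (Fin n → A) λ f → ∀ j → j ∈ I → P j (f j)
choose-on {A = A} {P} I default choice = (λ j → pick j (j ∈? I)) , λ j → pick-spec j (j ∈? I)
  where
  pick : ∀ j → Dec (j ∈ I) → A
  pick j (yes j∈I) = proj₁ (choice j j∈I)
  pick j (no  _)   = default
  pick-spec : ∀ j (j∈I? : Dec (j ∈ I)) → j ∈ I → P j (pick j j∈I?)
  pick-spec j (yes j∈I) _   = proj₂ (choice j j∈I)
  pick-spec j (no  j∉I) j∈I = Data.Empty.⊥-elim (j∉I j∈I)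

module Γ∞-Properties {g ℓ₁ ℓ₂} (Γ : OrderedAbelianGroup g ℓ₁ ℓ₂) where
  open OrderedAbelianGroup Γ
  open Γ∞ Γ
  private module ≤ = IsTotalOrder isTotalOrder

  open GroupProperties group using (identityʳ-unique)

  ≈∞-sym : ∀ {x y} → x ≈∞ y → y ≈∞ x
  ≈∞-sym {nothing} {nothing} _   = _
  ≈∞-sym {just _}  {just _}  x≈y = sym x≈y

  ≈∞-trans : ∀ {x y z} → x ≈∞ y → y ≈∞ z → x ≈∞ z
  ≈∞-trans {nothing} {nothing} {nothing} _   _   = _
  ≈∞-trans {just _}  {just _}  {just _}  x≈y y≈z = trans x≈y y≈z
  ≈∞-trans {just _}  {nothing} (lift ())
  ≈∞-trans {nothing} {just _}  (lift ())
  ≈∞-trans {y = just _}  {nothing} _ (lift ())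
  ≈∞-trans {y = nothing} {just _}  _ (lift ())

  ≈∞∞⇒≡∞ : ∀ {x} → x ≈∞ nothing → x ≡ nothing
  ≈∞∞⇒≡∞ {nothing} _ = ≡.refl
  ≈∞∞⇒≡∞ {just _} (lift ())

  ∞≤∞x⇒x≡∞ : ∀ {x} → nothing ≤∞ x → x ≡ nothing
  ∞≤∞x⇒x≡∞ {nothing} _ = ≡.refl
  ∞≤∞x⇒x≡∞ {just _} (lift ())

  x+∞x≈∞x⇒x≈∞ε : ∀ {x} → x ≢ nothing → (x +∞ x) ≈∞ x → x ≈∞ just ε
  x+∞x≈∞x⇒x≈∞ε {nothing} x≢∞ _ = Data.Empty.⊥-elim (x≢∞ ≡.refl)
  x+∞x≈∞x⇒x≈∞ε {just x}  _   x∙x≈x = identityʳ-unique x x x∙x≈x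

  ε≤x∙y : ∀ {x y} → ε ≤ x → ε ≤ y → ε ≤ (x ∙ y)
  ε≤x∙y {x} {y} ε≤x ε≤y = ≤.trans ε≤y (≤.≲-respˡ-≈ (identityˡ y) (+-mono-≤ y ε≤x))

  ε≤x∙x⇒ε≤x : ∀ {x} → ε ≤ (x ∙ x) → ε ≤ x
  ε≤x∙x⇒ε≤x {x} ε≤x∙x with ≤.total ε x
  ... | inj₁ ε≤x = ε≤x
  ... | inj₂ x≤ε = ≤.trans ε≤x∙x (≤.≲-respʳ-≈ (identityˡ x) (+-mono-≤ x x≤ε))

  ≤∞-refl : ∀ {x} → x ≤∞ x
  ≤∞-refl {nothing} = _
  ≤∞-refl {just x}  = ≤.refl

  ≤∞-trans : ∀ {x y z} → x ≤∞ y → y ≤∞ z → x ≤∞ z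
  ≤∞-trans {z = nothing} _ _ = _
  ≤∞-trans {y = nothing} {just _} _ (lift ())
  ≤∞-trans {nothing} {just _} {just _} (lift ())
  ≤∞-trans {just _} {just _} {just _} x≤y y≤z = ≤.trans x≤y y≤z

  ≤∞-isTotalPreorder : IsTotalPreorder _≡_ _≤∞_
  ≤∞-isTotalPreorder = record
    { isPreorder = record
      { isEquivalence = ≡.isEquivalence
      ; reflexive     = λ { {x} ≡.refl → ≤∞-refl {x} }
      ; trans         = λ {x} {y} {z} → ≤∞-trans {x} {y} {z}
      }
    ; total = total∞
    }
    where
    total∞ : ∀ x y → x ≤∞ y ⊎ y ≤∞ x
    total∞ _        nothing  = inj₁ _
    total∞ nothing  (just _) = inj₂ _
    total∞ (just x) (just y) = ≤.total x y

  ≤∞-respʳ-≈∞ : ∀ {x y z} → y ≈∞ z → x ≤∞ y → x ≤∞ z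
  ≤∞-respʳ-≈∞ {y = nothing} {nothing} _ x≤y = x≤y
  ≤∞-respʳ-≈∞ {just _} {just _} {just _} y≈z x≤y = ≤.≲-respʳ-≈ y≈z x≤y
  ≤∞-respʳ-≈∞ {nothing} {just _} {just _} _ (lift ())
  ≤∞-respʳ-≈∞ {y = just _} {nothing} _ _ = _

  +∞-monoˡ-≤∞ : ∀ {x y} z → x ≤∞ y → (x +∞ z) ≤∞ (y +∞ z)
  +∞-monoˡ-≤∞ {y = nothing} _ _ = _
  +∞-monoˡ-≤∞ {y = just _} nothing _ = _
  +∞-monoˡ-≤∞ {just _} {just _} (just z) x≤y = +-mono-≤ z x≤y
  +∞-monoˡ-≤∞ {nothing} {just _} (just _) (lift ())

  ε≤∞x+∞y : ∀ {x y} → just ε ≤∞ x → just ε ≤∞ y → just ε ≤∞ (x +∞ y)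
  ε≤∞x+∞y {just _} {just _} ε≤x ε≤y = ε≤x∙y ε≤x ε≤y
  ε≤∞x+∞y {just _} {nothing} _ _ = _
  ε≤∞x+∞y {nothing} _ _ = _

  ε≤∞x+∞x⇒ε≤∞x : ∀ {x} → just ε ≤∞ (x +∞ x) → just ε ≤∞ x
  ε≤∞x+∞x⇒ε≤∞x {just _} = ε≤x∙x⇒ε≤x
  ε≤∞x+∞x⇒ε≤∞x {nothing} _ = _

module LinearAlgebra {c ℓ} (F : Field c ℓ) (≈0? : ∀ x → Dec (Field._≈_ F x (Field.0# F))) where
  open Field F hiding (zero)
  open import Algebra.Properties.Semiring.Sum semiring
    using (sum; sum-cong-≋; sum-replicate-zero; sum-remove; ∑-distrib-+; ∑-comm; *-distribˡ-sum; *-distribʳ-sum)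
  open import Algebra.Properties.Ring ring using (-‿distribˡ-*; -‿distribʳ-*)
  open GroupProperties +-group using (x∙y⁻¹≈ε⇒x≈y; x≈y⇒x∙y⁻¹≈ε)
  open import Algebra.Properties.CommutativeSemigroup *-commutativeSemigroup using (x∙yz≈y∙xz)
  open import Relation.Binary.Reasoning.Setoid setoid

  1≉0 : ¬ 1# ≈ 0#
  1≉0 = 0≉1 ∘ sym

  _≈?_ : ∀ x y → Dec (x ≈ y)
  x ≈? y = map′ (x∙y⁻¹≈ε⇒x≈y x y) x≈y⇒x∙y⁻¹≈ε (≈0? (x - y))

  sum-zero : ∀ {n} {f : Fin n → Carrier} → (∀ j → f j ≈ 0#) → sum f ≈ 0#
  sum-zero {n} f≈0 = trans (sum-cong-≋ f≈0) (sum-replicate-zero n)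

  sum-supported-at : ∀ {n} (k : Fin n) (f : Fin n → Carrier) →
                     (∀ j → j ≢ k → f j ≈ 0#) → sum f ≈ f k
  sum-supported-at {suc n} k f f≈0 = begin
    sum f                    ≈⟨ sum-remove {i = k} f ⟩
    f k + sum (removeAt f k) ≈⟨ +-congˡ (sum-zero (λ j → f≈0 _ (punchInᵢ≢i k j))) ⟩
    f k + 0#                 ≈⟨ +-identityʳ (f k) ⟩
    f k                      ∎

  sum≉0⇒∃≉0 : ∀ {n} (f : Fin n → Carrier) → ¬ sum f ≈ 0# → ∃ λ j → ¬ f j ≈ 0#
  sum≉0⇒∃≉0 f sum≉0 with any? (λ j → ¬? (≈0? (f j)))
  ... | yes nonzero = nonzero
  ... | no  allZero = Data.Empty.⊥-elim (sum≉0 (sum-zero λ j →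
                        decidable-stable (≈0? (f j)) (λ f≉0 → allZero (j , f≉0))))

  single : ∀ {n} → Fin n → Carrier → Fin n → Carrier
  single k t j with k Fin.≟ j
  ... | yes _ = t
  ... | no  _ = 0#

  single-≡ : ∀ {n} (k : Fin n) t → single k t k ≈ t
  single-≡ k t with k Fin.≟ k
  ... | yes _   = refl
  ... | no  k≢k = Data.Empty.⊥-elim (k≢k ≡.refl)

  single-≢ : ∀ {n} {k j : Fin n} t → j ≢ k → single k t j ≈ 0#
  single-≢ {k = k} {j} t j≢k with k Fin.≟ j
  ... | yes k≡j = Data.Empty.⊥-elim (j≢k (≡.sym k≡j))
  ... | no  _   = refl

  single-≉0⇒≡ : ∀ {n} {k j : Fin n} {t} → ¬ single k t j ≈ 0# → j ≡ k
  single-≉0⇒≡ {k = k} {j} {t} ≉0 with j Fin.≟ k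
  ... | yes j≡k = j≡k
  ... | no  j≢k = Data.Empty.⊥-elim (≉0 (single-≢ t j≢k))

  infix 8 _·_
  _·_ : ∀ {n} → (Fin n → Carrier) → (Fin n → Carrier) → Carrier
  u · v = sum (λ j → u j * v j)

  ·-congʳ : ∀ {n} (u : Fin n → Carrier) {v w} → (∀ j → v j ≈ w j) → u · v ≈ u · w
  ·-congʳ u v≈w = sum-cong-≋ (λ j → *-congˡ (v≈w j))

  ·-comm : ∀ {n} (u v : Fin n → Carrier) → u · v ≈ v · u
  ·-comm u v = sum-cong-≋ (λ j → *-comm (u j) (v j))

  ·-distribʳ-+ : ∀ {n} (u v w : Fin n → Carrier) → (λ j → u j + v j) · w ≈ u · w + v · w
  ·-distribʳ-+ u v w = trans (sum-cong-≋ (λ j → distribʳ (w j) (u j) (v j)))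
                             (∑-distrib-+ (λ j → u j * w j) (λ j → v j * w j))

  *-·-assoc : ∀ {n} x (u v : Fin n → Carrier) → (λ j → x * u j) · v ≈ x * (u · v)
  *-·-assoc x u v = trans (sum-cong-≋ (λ j → *-assoc x (u j) (v j)))
                          (sym (*-distribˡ-sum x (λ j → u j * v j)))

  single-· : ∀ {n} (k : Fin n) t (u : Fin n → Carrier) → single k t · u ≈ t * u k
  single-· k t u = trans
    (sum-supported-at k _ (λ j j≢k → trans (*-congʳ (single-≢ t j≢k)) (zeroˡ (u j))))
    (*-congʳ (single-≡ k t))

  ·-+-*-distrib : ∀ {n} (u v w : Fin n → Carrier) x → u · (λ j → v j + w j * x) ≈ u · v + (u · w) * x
  ·-+-*-distrib u v w x = begin
    u · (λ j → v j + w j * x)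
      ≈⟨ sum-cong-≋ (λ j → trans (distribˡ (u j) (v j) (w j * x)) (+-congˡ (sym (*-assoc (u j) (w j) x)))) ⟩
    sum (λ j → u j * v j + u j * w j * x)
      ≈⟨ ∑-distrib-+ (λ j → u j * v j) (λ j → u j * w j * x) ⟩
    u · v + sum (λ j → u j * w j * x)
      ≈⟨ +-congˡ (sym (*-distribʳ-sum x (λ j → u j * w j))) ⟩
    u · v + (u · w) * x
      ∎

  ·-·-comm : ∀ {m n} (a : Fin m → Carrier) (b : Fin n → Carrier) (x : Fin n → Fin m → Carrier) →
             a · (λ r → b · (λ j → x j r)) ≈ b · (λ j → a · x j)
  ·-·-comm a b x = begin
    a · (λ r → b · (λ j → x j r))
      ≈⟨ sum-cong-≋ (λ r → *-distribˡ-sum (a r) (λ j → b j * x j r)) ⟩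
    sum (λ r → sum (λ j → a r * (b j * x j r)))
      ≈⟨ ∑-comm (λ r j → a r * (b j * x j r)) ⟩
    sum (λ j → sum (λ r → a r * (b j * x j r)))
      ≈⟨ sum-cong-≋ (λ j → sum-cong-≋ (λ r → x∙yz≈y∙xz (a r) (b j) (x j r))) ⟩
    sum (λ j → sum (λ r → b j * (a r * x j r)))
      ≈⟨ sum-cong-≋ (λ j → sym (*-distribˡ-sum (b j) (λ r → a r * x j r))) ⟩
    b · (λ j → a · x j)
      ∎

  record LinearDependenceOn {n m} (I : Subset n) (v : Fin n → Fin m → Carrier) : Set (c ⊔ ℓ) where
    field
      coeff      : Fin n → Carrier
      supported  : ∀ j → ¬ coeff j ≈ 0# → j ∈ I
      relation   : ∀ r → coeff · (λ j → v j r) ≈ 0#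
      nontrivial : ∃ λ j → ¬ coeff j ≈ 0#

  dependence-at : ∀ {n} {I : Subset n} {k} (v : Fin n → Fin 0 → Carrier) → k ∈ I → LinearDependenceOn I v
  dependence-at {I = I} {k} v k∈I = record
    { coeff      = single k 1#
    ; supported  = λ j ≉0 → ≡.subst (_∈ I) (≡.sym (single-≉0⇒≡ ≉0)) k∈I
    ; relation   = λ ()
    ; nontrivial = k , λ ≈0 → 1≉0 (trans (sym (single-≡ k 1#)) ≈0)
    }

  dependence-head-zero : ∀ {n m} {I : Subset n} (v : Fin n → Fin (suc m) → Carrier) →
                         (∀ j → j ∈ I → v j zero ≈ 0#) →
                         LinearDependenceOn I (λ j → v j ∘ suc) → LinearDependenceOn I v
  dependence-head-zero v head≈0 D = record
    { coeff      = coeff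
    ; supported  = supported
    ; relation   = λ { zero → sum-zero term≈0 ; (suc r) → relation r }
    ; nontrivial = nontrivial
    }
    where
    open LinearDependenceOn D
    term≈0 : ∀ j → coeff j * v j zero ≈ 0#
    term≈0 j with ≈0? (coeff j)
    ... | yes coeff≈0 = trans (*-congʳ coeff≈0) (zeroˡ (v j zero))
    ... | no  coeff≉0 = trans (*-congˡ (head≈0 j (supported j coeff≉0))) (zeroʳ (coeff j))

  -- Gaussian elimination with pivot v k zero, whose inverse is y
  eliminate : ∀ {n m} (v : Fin n → Fin (suc m) → Carrier) → Fin n → Carrier → Fin n → Fin m → Carrier
  eliminate v k y j r = v j (suc r) + v j zero * (- y * v k (suc r))

  dependence-by-elimination : ∀ {n m} {I : Subset n} {k} (v : Fin n → Fin (suc m) → Carrier) {y} →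
                              k ∈ I → v k zero * y ≈ 1# →
                              LinearDependenceOn (I ∖ k) (eliminate v k y) → LinearDependenceOn I v
  dependence-by-elimination {I = I} {k} v {y} k∈I pivot D = record
    { coeff      = coeff′
    ; supported  = supported′
    ; relation   = relation′
    ; nontrivial = j₀ , λ ≈0 → coeff[j₀]≉0 (trans (sym (coeff′≈coeff j₀≢k)) ≈0)
    }
    where
    open LinearDependenceOn D
    j₀ = proj₁ nontrivial
    coeff[j₀]≉0 = proj₂ nontrivial
    j₀≢k = x∈p∖y⇒x≢y (supported j₀ coeff[j₀]≉0)
    A = coeff · (λ j → v j zero)
    t = A * - y
    coeff′ : Fin _ → Carrier
    coeff′ j = coeff j + single k t j

    coeff′≈coeff : ∀ {j} → j ≢ k → coeff′ j ≈ coeff j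
    coeff′≈coeff j≢k = trans (+-congˡ (single-≢ t j≢k)) (+-identityʳ _)

    supported′ : ∀ j → ¬ coeff′ j ≈ 0# → j ∈ I
    supported′ j ≉0 with j Fin.≟ k
    ... | yes ≡.refl = k∈I
    ... | no  j≢k    = p─q⊆p I _ (supported j (λ ≈0 → ≉0 (trans (coeff′≈coeff j≢k) ≈0)))

    coeff′-· : ∀ u → coeff′ · u ≈ coeff · u + t * u k
    coeff′-· u = trans (·-distribʳ-+ coeff (single k t) u) (+-congˡ (single-· k t u))

    t*pivot≈-A : t * v k zero ≈ - A
    t*pivot≈-A = begin
      A * - y * v k zero     ≈⟨ *-assoc A (- y) (v k zero) ⟩
      A * (- y * v k zero)   ≈⟨ *-congˡ (sym (-‿distribˡ-* y (v k zero))) ⟩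
      A * - (y * v k zero)   ≈⟨ *-congˡ (-‿cong (trans (*-comm y (v k zero)) pivot)) ⟩
      A * - 1#               ≈⟨ sym (-‿distribʳ-* A 1#) ⟩
      - (A * 1#)             ≈⟨ -‿cong (*-identityʳ A) ⟩
      - A                    ∎

    relation′ : ∀ r → coeff′ · (λ j → v j r) ≈ 0#
    relation′ zero = begin
      coeff′ · (λ j → v j zero)  ≈⟨ coeff′-· (λ j → v j zero) ⟩
      A + t * v k zero           ≈⟨ +-congˡ t*pivot≈-A ⟩
      A + - A                    ≈⟨ -‿inverseʳ A ⟩
      0#                         ∎
    relation′ (suc r) = begin
      coeff′ · (λ j → v j (suc r))                                ≈⟨ coeff′-· (λ j → v j (suc r)) ⟩
      coeff · (λ j → v j (suc r)) + A * - y * v k (suc r)         ≈⟨ +-congˡ (*-assoc A (- y) (v k (suc r))) ⟩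
      coeff · (λ j → v j (suc r)) + A * (- y * v k (suc r))       ≈⟨ sym (·-+-*-distrib coeff _ _ _) ⟩
      coeff · (λ j → eliminate v k y j r)                         ≈⟨ relation r ⟩
      0#                                                          ∎

  dependent : ∀ m {n} (v : Fin n → Fin m → Carrier) (I : Subset n) → m < ∣ I ∣ → LinearDependenceOn I v
  dependent zero v I 0<∣I∣ = dependence-at v (proj₂ (0<∣p∣⇒nonempty 0<∣I∣))
  dependent (suc m) v I m<∣I∣ with any? (λ k → (k ∈? I) ×-dec ¬? (≈0? (v k zero)))
  ... | yes (k , k∈I , pivot≉0) =
    dependence-by-elimination v k∈I (proj₂ (inverse _ pivot≉0))
      (dependent m _ (I ∖ k) (ℕ.≤-pred (≡.subst (suc (suc m) ℕ.≤_) (x∈p⇒∣p∣≡1+∣p∖x∣ k∈I) m<∣I∣)))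
  ... | no  noPivot =
    dependence-head-zero v (λ j j∈I → decidable-stable (≈0? (v j zero)) (λ ≉0 → noPivot (j , j∈I , ≉0)))
      (dependent m _ I (ℕ.<⇒≤ m<∣I∣))

module _ {a ℓ₁ ℓ₂} {A : Set a} {_≈_ : Rel A ℓ₁} {_≲_ : Rel A ℓ₂}
         (≲-isTotalPreorder : IsTotalPreorder _≈_ _≲_) where
  open IsTotalPreorder ≲-isTotalPreorder

  argmin : ∀ {n} (f : Fin n → A) → Fin n → Σ (Fin n) λ k → ∀ j → f k ≲ f j
  argmin {suc zero}    f _ = zero , λ { zero → refl }
  argmin {suc (suc n)} f _ with argmin (f ∘ suc) zero
  ... | k , min with total (f zero) (f (suc k))
  ...   | inj₁ f[0]≲f[k] = zero  , λ { zero → refl ; (suc j) → trans f[0]≲f[k] (min j) }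
  ...   | inj₂ f[k]≲f[0] = suc k , λ { zero → f[k]≲f[0] ; (suc j) → min j }

module ValuedFieldProperties {c ℓ g ℓ₁ ℓ₂} (K : ValuedField c ℓ g ℓ₁ ℓ₂) where
  open ValuedField K hiding (zero)
  open Γ∞-Properties valueGroup
  open import Algebra.Properties.Ring ring using (-1*x≈-x; -‿involutive)

  ≈0⇒ν≡∞ : ∀ {x} → x ≈ 0# → ν x ≡ nothing
  ≈0⇒ν≡∞ {x} x≈0 = ≈∞∞⇒≡∞ (≡.subst (ν x ≈∞_) ν-0 (ν-cong x≈0))

  ≈0? : ∀ x → Dec (x ≈ 0#)
  ≈0? x with ν x in ν[x]≡
  ... | nothing = yes (ν-∞⇒0 x ν[x]≡)
  ... | just _  = no λ x≈0 → case ≡.trans (≡.sym ν[x]≡) (≈0⇒ν≡∞ x≈0) of λ ()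

  open LinearAlgebra field' ≈0? public

  ν≤∞ν⇒≉0 : ∀ {x y} → ν x ≤∞ ν y → ¬ y ≈ 0# → ¬ x ≈ 0#
  ν≤∞ν⇒≉0 {x} {y} ν[x]≤ν[y] y≉0 x≈0 =
    y≉0 (ν-∞⇒0 y (∞≤∞x⇒x≡∞ (≡.subst (_≤∞ ν y) (≈0⇒ν≡∞ x≈0) ν[x]≤ν[y])))

  ν[1]≈∞ε : ν 1# ≈∞ just 0Γ
  ν[1]≈∞ε = x+∞x≈∞x⇒x≈∞ε (1≉0 ∘ ν-∞⇒0 1#)
    (≈∞-trans {ν 1# +∞ ν 1#} {ν (1# * 1#)} {ν 1#} (≈∞-sym {ν (1# * 1#)} (ν-* 1# 1#)) (ν-cong (*-identityˡ 1#)))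

  𝒪-cong : ∀ {x y} → x ≈ y → 𝒪 K x → 𝒪 K y
  𝒪-cong {x} {y} x≈y = ≤∞-respʳ-≈∞ {just 0Γ} {ν x} {ν y} (ν-cong x≈y)

  𝒪-0 : 𝒪 K 0#
  𝒪-0 = ≡.subst (just 0Γ ≤∞_) (≡.sym ν-0) _

  𝒪-1 : 𝒪 K 1#
  𝒪-1 = ≤∞-respʳ-≈∞ {just 0Γ} {just 0Γ} {ν 1#} (≈∞-sym {ν 1#} ν[1]≈∞ε) (≤∞-refl {just 0Γ})

  𝒪-* : ∀ {x y} → 𝒪 K x → 𝒪 K y → 𝒪 K (x * y)
  𝒪-* {x} {y} 𝒪x 𝒪y = ≤∞-respʳ-≈∞ {just 0Γ} {ν x +∞ ν y} {ν (x * y)}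
    (≈∞-sym {ν (x * y)} (ν-* x y)) (ε≤∞x+∞y {ν x} {ν y} 𝒪x 𝒪y)

  𝒪-‿1 : 𝒪 K (- 1#)
  𝒪-‿1 = ε≤∞x+∞x⇒ε≤∞x {ν (- 1#)}
    (≤∞-respʳ-≈∞ {just 0Γ} {ν (- 1# * - 1#)} (ν-* (- 1#) (- 1#)) (𝒪-cong (sym -1*-1≈1) 𝒪-1))
    where
    -1*-1≈1 : - 1# * - 1# ≈ 1#
    -1*-1≈1 = trans (-1*x≈-x (- 1#)) (-‿involutive 1#)

  𝒪-‿ : ∀ {x} → 𝒪 K x → 𝒪 K (- x)
  𝒪-‿ {x} 𝒪x = 𝒪-cong (-1*x≈-x x) (𝒪-* 𝒪-‿1 𝒪x)

  𝒪-quotient : ∀ {a x y} → a * y ≈ 1# → ν a ≤∞ ν x → 𝒪 K (x * y)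
  𝒪-quotient {a} {x} {y} a*y≈1 ν[a]≤ν[x] =
    ≤∞-respʳ-≈∞ {just 0Γ} {ν x +∞ ν y} {ν (x * y)} (≈∞-sym {ν (x * y)} (ν-* x y))
      (≤∞-trans {just 0Γ} {ν a +∞ ν y} {ν x +∞ ν y}
        (≤∞-respʳ-≈∞ {just 0Γ} {ν (a * y)} (ν-* a y) (𝒪-cong (sym a*y≈1) 𝒪-1))
        (+∞-monoˡ-≤∞ {ν a} {ν x} (ν y) ν[a]≤ν[x]))

module Convexity {c ℓ g ℓ₁ ℓ₂} (K : ValuedField c ℓ g ℓ₁ ℓ₂) where
  open ValuedField K hiding (zero)
  open ValuedFieldProperties K
  open Γ∞-Properties valueGroup using (≤∞-isTotalPreorder)
  open import Algebra.Properties.Semiring.Sum semiring using (sum; sum-cong-≋; *-distribʳ-sum)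
  open import Algebra.Properties.Ring ring using (-‿distribˡ-*; -0#≈0#)
  open import Relation.Binary.Reasoning.Setoid setoid

  record InHull {n d} (J : Subset n) (x : Fin n → Point K d) (y : Point K d) : Set (c ⊔ ℓ ⊔ ℓ₂) where
    field
      weight       : Fin n → Carrier
      weight∈𝒪     : ∀ j → 𝒪 K (weight j)
      supported    : ∀ j → ¬ weight j ≈ 0# → j ∈ J
      sum≈1        : sum weight ≈ 1#
      combination≈ : _≈ᵈ_ K (combination K weight x) y

  ∈-hull : ∀ {p d n} {J : Subset n} {x y} (X : ConvexSet K p d) →
           (∀ j → j ∈ J → set X ∋ x j) → InHull J x y → set X ∋ y
  ∈-hull {n = zero}  X _ H = Data.Empty.⊥-elim (0≉1 (InHull.sum≈1 H))
  ∈-hull {d = d} {suc n} {J} {x} X x∈X H =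
    resp (set X) (λ r → trans (sum-cong-≋ (λ j → weight*pad j (≈0? (weight j)) r)) (combination≈ r))
      (convex X n (λ j → pad j (≈0? (weight j))) weight (λ j → pad∈X j (≈0? (weight j))) weight∈𝒪 sum≈1)
    where
    open InHull H
    j₀ = sum≉0⇒∃≉0 weight (λ ≈0 → 0≉1 (trans (sym ≈0) sum≈1))
    -- points of weight zero need not lie in X, so they are replaced by one that does
    pad : ∀ j → Dec (weight j ≈ 0#) → Point K d
    pad j (yes _) = x (proj₁ j₀)
    pad j (no  _) = x j
    pad∈X : ∀ j w≈0? → set X ∋ pad j w≈0?
    pad∈X j (yes _)   = x∈X (proj₁ j₀) (supported (proj₁ j₀) (proj₂ j₀))
    pad∈X j (no  w≉0) = x∈X j (supported j w≉0)
    weight*pad : ∀ j w≈0? r → weight j * pad j w≈0? r ≈ weight j * x j r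
    weight*pad j (yes w≈0) r = trans (trans (*-congʳ w≈0) (zeroˡ _)) (sym (trans (*-congʳ w≈0) (zeroˡ _)))
    weight*pad j (no  _)   r = refl

  radon : ∀ {n d} (x : Fin n → Point K d) (I : Subset n) → suc d < ∣ I ∣ →
          ∃ λ k → k ∈ I × InHull (I ∖ k) x (x k)
  radon {n} {d} x I d+1<∣I∣ = k , k∈I , record
    { weight       = weight
    ; weight∈𝒪     = weight∈𝒪
    ; supported    = supported′
    ; sum≈1        = trans (sum-cong-≋ (λ j → sym (*-identityʳ (weight j)))) (weight-· (relation zero))
    ; combination≈ = λ r → weight-· (relation (suc r))
    }
    where
    -- an affine dependence among the x j is a linear one among the x̂ j
    x̂ : Fin n → Fin (suc d) → Carrier
    x̂ j zero    = 1#
    x̂ j (suc r) = x j r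
    open LinearDependenceOn (dependent (suc d) x̂ I d+1<∣I∣)
    -- normalise the relation by its coefficient of least valuation, so all weights lie in 𝒪
    k,min = argmin ≤∞-isTotalPreorder (ν ∘ coeff) (proj₁ nontrivial)
    k = proj₁ k,min
    min = proj₂ k,min
    coeff[k]≉0 = ν≤∞ν⇒≉0 (min (proj₁ nontrivial)) (proj₂ nontrivial)
    k∈I = supported k coeff[k]≉0
    y = proj₁ (inverse (coeff k) coeff[k]≉0)
    coeff[k]*y≈1 = proj₂ (inverse (coeff k) coeff[k]≉0)

    weight : Fin n → Carrier
    weight j = - y * coeff j + single k 1# j

    weight-· : ∀ {u} → coeff · u ≈ 0# → weight · u ≈ u k
    weight-· {u} coeff·u≈0 = begin
      weight · u                         ≈⟨ ·-distribʳ-+ (λ j → - y * coeff j) (single k 1#) u ⟩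
      (λ j → - y * coeff j) · u + single k 1# · u
                                         ≈⟨ +-cong (*-·-assoc (- y) coeff u) (single-· k 1# u) ⟩
      - y * (coeff · u) + 1# * u k       ≈⟨ +-cong (trans (*-congˡ coeff·u≈0) (zeroʳ (- y))) (*-identityˡ (u k)) ⟩
      0# + u k                           ≈⟨ +-identityˡ (u k) ⟩
      u k                                ∎

    weight[k]≈0 : weight k ≈ 0#
    weight[k]≈0 = begin
      - y * coeff k + single k 1# k  ≈⟨ +-cong (sym (-‿distribˡ-* y (coeff k))) (single-≡ k 1#) ⟩
      - (y * coeff k) + 1#           ≈⟨ +-congʳ (-‿cong (trans (*-comm y (coeff k)) coeff[k]*y≈1)) ⟩
      - 1# + 1#                      ≈⟨ -‿inverseˡ 1# ⟩
      0#                             ∎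

    weight≈ : ∀ {j} → j ≢ k → weight j ≈ - (coeff j * y)
    weight≈ {j} j≢k = begin
      - y * coeff j + single k 1# j  ≈⟨ +-congˡ (single-≢ 1# j≢k) ⟩
      - y * coeff j + 0#             ≈⟨ +-identityʳ _ ⟩
      - y * coeff j                  ≈⟨ sym (-‿distribˡ-* y (coeff j)) ⟩
      - (y * coeff j)                ≈⟨ -‿cong (*-comm y (coeff j)) ⟩
      - (coeff j * y)                ∎

    weight∈𝒪 : ∀ j → 𝒪 K (weight j)
    weight∈𝒪 j with j Fin.≟ k
    ... | yes ≡.refl = 𝒪-cong (sym weight[k]≈0) 𝒪-0
    ... | no  j≢k    = 𝒪-cong (sym (weight≈ j≢k)) (𝒪-‿ (𝒪-quotient coeff[k]*y≈1 (min j)))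

    supported′ : ∀ j → ¬ weight j ≈ 0# → j ∈ I ∖ k
    supported′ j weight≉0 with j Fin.≟ k
    ... | yes ≡.refl = Data.Empty.⊥-elim (weight≉0 weight[k]≈0)
    ... | no  j≢k    = x∈p∧x≢y⇒x∈p-y (supported j coeff≉0) j≢k
      where
      coeff≉0 : ¬ coeff j ≈ 0#
      coeff≉0 coeff≈0 = weight≉0 (trans (weight≈ j≢k)
        (trans (-‿cong (trans (*-congʳ coeff≈0) (zeroˡ y))) (-0#≈0#)))

  module _ {p d n} (S : Fin n → ConvexSet K p d) where

    meetsOn-from-deletions : ∀ (I : Subset n) → suc d < ∣ I ∣ →
                             (∀ j → j ∈ I → MeetsOn K S (I ∖ j)) → MeetsOn K S I
    meetsOn-from-deletions I d+1<∣I∣ meets∖ = x k , x[k]∈S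
      where
      x,x∈S = choose-on I (λ _ → 0#) meets∖
      x = proj₁ x,x∈S
      x∈S = proj₂ x,x∈S
      k,hull = radon x I d+1<∣I∣
      k = proj₁ k,hull
      k∈I = proj₁ (proj₂ k,hull)
      x[k]∈S : ∀ i → i ∈ I → set (S i) ∋ x k
      x[k]∈S i i∈I with i Fin.≟ k
      ... | no  i≢k    = x∈S k k∈I i (x∈p∧x≢y⇒x∈p-y i∈I i≢k)
      ... | yes ≡.refl = ∈-hull (S k) x[j]∈S[k] (proj₂ (proj₂ k,hull))
        where
        x[j]∈S[k] : ∀ j → j ∈ I ∖ k → set (S k) ∋ x j
        x[j]∈S[k] j j∈I∖k =
          x∈S j (p─q⊆p I _ j∈I∖k) k (x∈p∧x≢y⇒x∈p-y k∈I (≢-sym (x∈p∖y⇒x≢y j∈I∖k)))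

    meetsOn-small⇒meetsOn : (∀ I → ∣ I ∣ ℕ.≤ suc d → MeetsOn K S I) →
                            ∀ s (I : Subset n) → ∣ I ∣ ℕ.≤ s → MeetsOn K S I
    meetsOn-small⇒meetsOn small zero I ∣I∣≤0 = small I (ℕ.≤-trans ∣I∣≤0 ℕ.z≤n)
    meetsOn-small⇒meetsOn small (suc s) I ∣I∣≤s+1 with ∣ I ∣ ℕ.≤? suc d
    ... | yes ∣I∣≤d+1 = small I ∣I∣≤d+1
    ... | no  ∣I∣≰d+1 = meetsOn-from-deletions I (ℕ.≰⇒> ∣I∣≰d+1) λ j j∈I →
      meetsOn-small⇒meetsOn small s (I ∖ j) (ℕ.≤-pred (ℕ.≤-trans (x∈p⇒∣p-x∣<∣p∣ j∈I) ∣I∣≤s+1))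

  helly : ∀ p d → HellyProperty K p d (suc d)
  helly p d n S small with meetsOn-small⇒meetsOn S small n ⊤ (∣p∣≤n ⊤)
  ... | x , x∈S = x , λ i → x∈S i ∈⊤

  module _ (p : Level) where

    infix 4 _≈ₚ_

    -- ≈ recast in Set p, which is possible at every level p because ≈ is decidable
    _≈ₚ_ : Carrier → Carrier → Set p
    x ≈ₚ y = Lift p (True (x ≈? y))

    ≈⇒≈ₚ : ∀ {x y} → x ≈ y → x ≈ₚ y
    ≈⇒≈ₚ = lift ∘ fromWitness

    ≈ₚ⇒≈ : ∀ {x y} → x ≈ₚ y → x ≈ y
    ≈ₚ⇒≈ = toWitness ∘ lower

    hyperplane : ∀ {d} → Point K d → Carrier → ConvexSet K p d
    hyperplane a b = record
      { set    = record
        { _∋_  = λ x → a · x ≈ₚ b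
        ; resp = λ x≈y a·x≈b → ≈⇒≈ₚ (trans (·-congʳ a (λ j → sym (x≈y j))) (≈ₚ⇒≈ a·x≈b))
        }
      ; convex = λ n x α x∈ _ sum[α]≈1 → ≈⇒≈ₚ (begin
          a · combination K α x     ≈⟨ ·-·-comm a α x ⟩
          α · (λ j → a · x j)       ≈⟨ ·-congʳ α (λ j → ≈ₚ⇒≈ (x∈ j)) ⟩
          α · (λ _ → b)             ≈⟨ sym (*-distribʳ-sum b α) ⟩
          sum α * b                 ≈⟨ *-congʳ sum[α]≈1 ⟩
          1# * b                    ≈⟨ *-identityˡ b ⟩
          b                         ∎)
      }

    counterexample : ∀ d → Fin (suc d) → ConvexSet K p d
    counterexample d zero    = hyperplane (λ _ → 1#) 1#
    counterexample d (suc i) = hyperplane (single i 1#) 0#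

    meetsOn-counterexample : ∀ {d} (I : Subset (suc d)) j → j ∉ I → MeetsOn K (counterexample d) I
    meetsOn-counterexample I zero 0∉I = (λ _ → 0#) , origin∈
      where
      origin∈ : ∀ i → i ∈ I → set (counterexample _ i) ∋ (λ _ → 0#)
      origin∈ zero    0∈I = Data.Empty.⊥-elim (0∉I 0∈I)
      origin∈ (suc i) _   = ≈⇒≈ₚ (sum-zero (λ r → zeroʳ (single i 1# r)))
    meetsOn-counterexample I (suc r) r+1∉I = single r 1# , eᵣ∈
      where
      eᵣ∈ : ∀ i → i ∈ I → set (counterexample _ i) ∋ single r 1#
      eᵣ∈ zero    _   = ≈⇒≈ₚ (trans (·-comm _ (single r 1#)) (trans (single-· r 1# _) (*-identityˡ 1#)))
      eᵣ∈ (suc i) i+1∈I = ≈⇒≈ₚ (trans (single-· i 1# (single r 1#))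
        (trans (*-identityˡ _) (single-≢ 1# λ i≡r → r+1∉I (≡.subst (λ j → suc j ∈ I) i≡r i+1∈I))))

    ¬meets-counterexample : ∀ d → ¬ Meets K (counterexample d)
    ¬meets-counterexample d (x , x∈) = 0≉1 (begin
      0#               ≈⟨ sym (sum-zero (λ r → trans (*-identityˡ (x r)) (x[r]≈0 r))) ⟩
      (λ _ → 1#) · x   ≈⟨ ≈ₚ⇒≈ (x∈ zero) ⟩
      1#               ∎)
      where
      x[r]≈0 : ∀ r → x r ≈ 0#
      x[r]≈0 r = trans (sym (trans (single-· r 1# x) (*-identityˡ (x r)))) (≈ₚ⇒≈ (x∈ (suc r)))

    ¬helly : ∀ d m → m < suc d → ¬ HellyProperty K p d m
    ¬helly d m m<d+1 helly-m = ¬meets-counterexample d (helly-m (suc d) (counterexample d) small)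
      where
      small : ∀ I → ∣ I ∣ ℕ.≤ m → MeetsOn K (counterexample d) I
      small I ∣I∣≤m with ∣p∣<n⇒∃∉ (ℕ.≤-<-trans ∣I∣≤m m<d+1)
      ... | j , j∉I = meetsOn-counterexample I j j∉I

-- the argument does not need d ≥ 1
theorem4p5 : ∀ {c ℓ g ℓ₁ ℓ₂ : Level} (p : Level) (K : ValuedField c ℓ g ℓ₁ ℓ₂)
    (d : ℕ) → d ≥ 1 → HellyNumber K p d (suc d)
theorem4p5 p K d _ = helly p d , ¬helly p d
  where open Convexity K
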